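{- Let $\mathbf{s}=(s_i)_{i\in\omega}$ be a sequence of pairwise disjoint elements of $\mathbb{F}$ such that for every $n$ there exist $i_0<\dots<i_n$ for which the meshing graph $G_{(s_{i_0},\ldots,s_{i_n})}$ is complete. If $A,B\subseteq\omega$ are such that $A\cap\min[FU(\mathbf{s})]$ and $B\cap\max[FU(\mathbf{s})]$ are both infinite, then \[\{x\in\mathbb{F}:\min(x)\in A\}\cap\{x\in\mathbb{F}:\max(x)\in B\}\] is $\mathbf{s}$-meshed.
   Context: $\mathbb{F}$ denotes the set of nonempty finite subsets of $\omega$. For $s,t\in\mathbb{F}$ write $s<t$ iff $\max(s)<\min(t)$ and $s\sqcap t$ (mesh) if neither $s<t$ nor $t<s$. For a sequence $\mathbf{x}=(x_i)_{i<N}$ of pairwise disjoint elements of $\mathbb{F}$, $FU(\mathbf{x})=\{\bigcup_{i\in v}x_i: v \text{ a nonempty finite subset of } N\}$; $\mathbf{y}\sqsubseteq\mathbf{x}$ means $FU(\mathbf{y})\subseteq FU(\mathbf{x})$. $\min[FU(\mathbf{s})]=\{\min x: x\in FU(\mathbf{s})\}$, similarly $\max[FU(\mathbf{s})]$. For $z\in FU(\mathbf{s})$, "$s_n\subseteq z$" means $n$ belongs to the unique finite $v$ with $z=\bigcup_{i\in v}s_i$. Given a sequence $\mathbf{t}=(t_j)_{j<K}$ of pairwise disjoint elements with $\mathbf{t}\sqsubseteq\mathbf{s}$, the meshing graph $G_{\mathbf{t}}$ has vertices $\{t_j\}$ and an edge $\{t_i,t_j\}$ whenever there are $s_n\subseteq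 t_i$, $s_m\subseteq t_j$ with $s_n\sqcap s_m$. A set $A\subseteq\mathbb{F}$ is $\mathbf{s}$-meshed if for every $n\in\omega$ there is a sequence $\mathbf{t}=(t_i)_{i<n}$ of pairwise disjoint elements with $FU(\mathbf{t})\subseteq FU(\mathbf{s})\cap A$ and $G_{\mathbf{t}}$ complete. -}

module Defs where

open import Level using (0ℓ)
open import Data.Nat using (ℕ; _≤_; _<_)
open import Data.Fin as Fin using (Fin)
open import Data.List using (List; []; concatMap)
open import Data.List.Membership.Propositional using (_∈_; _∉_)
open import Data.Product using (Σ; ∃; ∃-syntax; _×_)
open import Function.Bundles using (_⇔_)
open import Relation.Binary.PropositionalEquality using (_≡_; _≢_)
open import Relation.Nullary using (¬_)
open import Relation.Unary using (Pred)

-- Finite subsets of ω are represented by lists of naturals, compared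
-- extensionally (by membership).  An element of 𝔽 is a nonempty such list.
FinSet : Set
FinSet = List ℕ

NonEmpty : {A : Set} → List A → Set
NonEmpty x = x ≢ []

_≐_ : FinSet → FinSet → Set
x ≐ y = ∀ k → (k ∈ x) ⇔ (k ∈ y)

Disjoint : FinSet → FinSet → Set
Disjoint x y = ∀ k → k ∈ x → k ∉ y

IsMin : FinSet → ℕ → Set
IsMin x m = m ∈ x × (∀ k → k ∈ x → m ≤ k)

IsMax : FinSet → ℕ → Set
IsMax x m = m ∈ x × (∀ k → k ∈ x → k ≤ m)

_≺_ : FinSet → FinSet → Set
s ≺ t = ∃[ a ] ∃[ b ] (IsMax s a × IsMin t b × a < b)

Mesh : FinSet → FinSet → Set
Mesh s t = ¬ (s ≺ t) × ¬ (t ≺ s)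

-- a sequence indexed by I (I = ℕ for ω-sequences, I = Fin N for finite ones)
PairwiseDisjoint : {I : Set} → (I → FinSet) → Set
PairwiseDisjoint {I} x = ∀ (i j : I) → i ≢ j → Disjoint (x i) (x j)

Union : {I : Set} → (I → FinSet) → List I → FinSet
Union x v = concatMap x v

-- z ∈ FU(x): z = ⋃_{i∈v} x_i for some nonempty finite set v of indices
-- (v given as a nonempty list; repetitions do not affect the union)
InFU : {I : Set} → (I → FinSet) → FinSet → Set
InFU {I} x z = Σ (List I) λ v → NonEmpty v × z ≐ Union x v

-- "s_n ⊆ z" for z ∈ FU(s): n belongs to the index set v with z = ⋃_{i∈v} s_i
-- (v is unique since the s_i are pairwise disjoint and nonempty)
Part : (ℕ → FinSet) → ℕ → FinSet → Set
Part s n z = Σ (List ℕ) λ v → NonEmpty v × z ≐ Union s v × n ∈ v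

_⊑_ : {I J : Set} → (J → FinSet) → (I → FinSet) → Set
y ⊑ x = ∀ z → InFU y z → InFU x z

MeshEdge : {J : Set} → (ℕ → FinSet) → (J → FinSet) → J → J → Set
MeshEdge s t i j = ∃[ n ] ∃[ m ] (Part s n (t i) × Part s m (t j) × Mesh (s n) (s m))

CompleteMeshGraph : {J : Set} → (ℕ → FinSet) → (J → FinSet) → Set
CompleteMeshGraph {J} s t = ∀ (i j : J) → i ≢ j → MeshEdge s t i j

Meshed : (ℕ → FinSet) → Pred FinSet 0ℓ → Set
Meshed s A = ∀ (n : ℕ) → Σ (Fin n → FinSet) λ t →
  (∀ i → NonEmpty (t i)) × PairwiseDisjoint t ×
  (∀ z → InFU t z → InFU s z × A z) × CompleteMeshGraph s t

MinFU : (ℕ → FinSet) → ℕ → Set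
MinFU s m = ∃[ z ] (InFU s z × IsMin z m)

MaxFU : (ℕ → FinSet) → ℕ → Set
MaxFU s m = ∃[ z ] (InFU s z × IsMax z m)

Infinite : Pred ℕ 0ℓ → Set
Infinite P = ∀ k → ∃[ m ] (k ≤ m × P m)

MinMaxIn : Pred ℕ 0ℓ → Pred ℕ 0ℓ → Pred FinSet 0ℓ
MinMaxIn A B x = NonEmpty x × (∃[ m ] (IsMin x m × A m)) × (∃[ m ] (IsMax x m × B m))

module Submission where

-- We build n pairwise disjoint sets t_j = P_j ∪ I_j ∪ Q_j, each a
-- union of three pieces of s placed in three disjoint "layers" of ω:
--   * P_j is a piece whose minimum a_j lies in A (pieces ≤ M);
--   * I_j runs through n members of a family with complete meshing graph,
--     chosen with all points above M (they lie in (M, M₂]);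
--   * Q_j is a piece whose maximum b_j lies in B, with all points above M₂.
-- Then min t_j = a_j ∈ A, max t_j = b_j ∈ B, and any two t_j mesh through
-- their I-pieces.  Minima and maxima of unions of the t_j are again among
-- the a_j and b_j, so FU(t) lies in the required set.

open import Defs
open import Level using (0ℓ)
open import Data.Nat using (ℕ; zero; suc; _+_; _≤_; _<_; s≤s; _≤?_)
open import Data.Nat.Properties
open import Data.Fin as Fin using (Fin; toℕ; fromℕ<; inject≤)
import Data.Fin.Properties as Finₚ
open import Data.List using (List; []; _∷_; _++_; length; lookup; filter; concatMap; tabulate; allFin; upTo)
open import Data.List.Properties using (++-identityʳ; concatMap-++; length-tabulate; length-upTo)
open import Data.List.Extrema.Nat using (max; xs≤max)
open import Data.List.Membership.Propositional using (_∈_; find)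
open import Data.List.Membership.Propositional.Properties
  using (∈-++⁺ˡ; ∈-++⁺ʳ; ∈-++⁻; ∈-concatMap⁺; ∈-concatMap⁻; ∈-lookup; ∈-filter⁻; ∈-tabulate⁺)
open import Data.List.Relation.Unary.Any as Any using (Any; here; there; any?)
open import Data.List.Relation.Unary.All as All using (All)
open import Data.List.Relation.Unary.All.Properties using (¬Any⇒All¬)
open import Data.List.Relation.Unary.AllPairs using (_∷_)
open import Data.List.Relation.Unary.Unique.Propositional using (Unique)
import Data.List.Relation.Unary.Unique.Propositional.Properties as Uniqueₚ
open import Data.Product using (Σ; ∃-syntax; _×_; _,_; proj₁; proj₂)
open import Data.Empty using (⊥)
open import Data.Sum using (_⊎_; inj₁; inj₂)
open import Function using (_∘_; id)
open import Function.Bundles using (_⇔_; mk⇔; Equivalence)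
open import Function.Definitions using (Injective)
open import Relation.Binary using (Rel; Trichotomous; tri<; tri≈; tri>; DecidableEquality)
open import Relation.Binary.PropositionalEquality
open import Relation.Nullary using (¬_; yes; no; contradiction)
open import Relation.Unary using (Pred; _∩_; Decidable)
open import Relation.Unary.Properties using (∁?)

open Equivalence using (to; from)

∈⇒nonEmpty : ∀ {y : ℕ} {z : FinSet} → y ∈ z → NonEmpty z
∈⇒nonEmpty () refl

∈-Union⁺ : ∀ {I : Set} (x : I → FinSet) {v : List I} {i y} → i ∈ v → y ∈ x i → y ∈ Union x v
∈-Union⁺ x i∈v y∈xi = ∈-concatMap⁺ x (Any.map (λ { refl → y∈xi }) i∈v)

∈-Union⁻ : ∀ {I : Set} (x : I → FinSet) (v : List I) {y} → y ∈ Union x v → ∃[ i ] (i ∈ v × y ∈ x i)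
∈-Union⁻ x v y∈ = find (∈-concatMap⁻ x {xs = v} y∈)

∈-Union₃⁻ : ∀ {I : Set} (x : I → FinSet) {p q r : I} {y} →
  y ∈ Union x (p ∷ q ∷ r ∷ []) → y ∈ x p ⊎ y ∈ x q ⊎ y ∈ x r
∈-Union₃⁻ x {p} {q} {r} y∈ with ∈-++⁻ (x p) y∈
... | inj₁ y∈p = inj₁ y∈p
... | inj₂ y∈qr with ∈-++⁻ (x q) y∈qr
...   | inj₁ y∈q = inj₂ (inj₁ y∈q)
...   | inj₂ y∈r = inj₂ (inj₂ (subst (_ ∈_) (++-identityʳ (x r)) y∈r))

Union-Union : ∀ {I J : Set} (x : I → FinSet) (v : J → List I) (w : List J) →
  Union (Union x ∘ v) w ≡ Union x (concatMap v w)
Union-Union x v [] = refl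
Union-Union x v (j ∷ w) = begin
  Union x (v j) ++ Union (Union x ∘ v) w  ≡⟨ cong (Union x (v j) ++_) (Union-Union x v w) ⟩
  Union x (v j) ++ Union x (concatMap v w) ≡⟨ concatMap-++ x (v j) (concatMap v w) ⟨
  Union x (v j ++ concatMap v w)           ∎
  where open ≡-Reasoning

MinIn MaxIn : Pred ℕ 0ℓ → FinSet → Set
MinIn P x = ∃[ m ] (IsMin x m × P m)
MaxIn P x = ∃[ m ] (IsMax x m × P m)

isMin-unique : ∀ {x a b} → IsMin x a → IsMin x b → a ≡ b
isMin-unique (a∈x , a≤) (b∈x , b≤) = ≤-antisym (a≤ _ b∈x) (b≤ _ a∈x)

isMax-unique : ∀ {x a b} → IsMax x a → IsMax x b → a ≡ b
isMax-unique (a∈x , ≤a) (b∈x , ≤b) = ≤-antisym (≤b _ a∈x) (≤a _ b∈x)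

minIn-≐ : ∀ {P x y} → x ≐ y → MinIn P y → MinIn P x
minIn-≐ x≐y (m , (m∈y , m≤) , Pm) = m , (from (x≐y m) m∈y , λ k k∈x → m≤ k (to (x≐y k) k∈x)) , Pm

maxIn-≐ : ∀ {P x y} → x ≐ y → MaxIn P y → MaxIn P x
maxIn-≐ x≐y (m , (m∈y , ≤m) , Pm) = m , (from (x≐y m) m∈y , λ k k∈x → ≤m k (to (x≐y k) k∈x)) , Pm

minIn-++ : ∀ {P x y} → MinIn P x → MinIn P y → MinIn P (x ++ y)
minIn-++ {x = x} (a , (a∈x , a≤) , Pa) (b , (b∈y , b≤) , Pb) with a ≤? b
... | yes a≤b = a , (∈-++⁺ˡ a∈x , lower) , Pa
  where
  lower : ∀ k → k ∈ x ++ _ → a ≤ k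
  lower k k∈ with ∈-++⁻ x k∈
  ... | inj₁ k∈x = a≤ k k∈x
  ... | inj₂ k∈y = ≤-trans a≤b (b≤ k k∈y)
... | no a≰b = b , (∈-++⁺ʳ x b∈y , lower) , Pb
  where
  lower : ∀ k → k ∈ x ++ _ → b ≤ k
  lower k k∈ with ∈-++⁻ x k∈
  ... | inj₁ k∈x = ≤-trans (<⇒≤ (≰⇒> a≰b)) (a≤ k k∈x)
  ... | inj₂ k∈y = b≤ k k∈y

maxIn-++ : ∀ {P x y} → MaxIn P x → MaxIn P y → MaxIn P (x ++ y)
maxIn-++ {x = x} (a , (a∈x , ≤a) , Pa) (b , (b∈y , ≤b) , Pb) with b ≤? a
... | yes b≤a = a , (∈-++⁺ˡ a∈x , upper) , Pa
  where
  upper : ∀ k → k ∈ x ++ _ → k ≤ a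
  upper k k∈ with ∈-++⁻ x k∈
  ... | inj₁ k∈x = ≤a k k∈x
  ... | inj₂ k∈y = ≤-trans (≤b k k∈y) b≤a
... | no b≰a = b , (∈-++⁺ʳ x b∈y , upper) , Pb
  where
  upper : ∀ k → k ∈ x ++ _ → k ≤ b
  upper k k∈ with ∈-++⁻ x k∈
  ... | inj₁ k∈x = ≤-trans (≤a k k∈x) (<⇒≤ (≰⇒> b≰a))
  ... | inj₂ k∈y = ≤b k k∈y

minIn-Union : ∀ {I : Set} {P} (t : I → FinSet) → (∀ j → MinIn P (t j)) → ∀ j w → MinIn P (Union t (j ∷ w))
minIn-Union {P = P} t h j [] = subst (MinIn P) (sym (++-identityʳ (t j))) (h j)
minIn-Union t h j (j′ ∷ w) = minIn-++ (h j) (minIn-Union t h j′ w)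

maxIn-Union : ∀ {I : Set} {P} (t : I → FinSet) → (∀ j → MaxIn P (t j)) → ∀ j w → MaxIn P (Union t (j ∷ w))
maxIn-Union {P = P} t h j [] = subst (MaxIn P) (sym (++-identityʳ (t j))) (h j)
maxIn-Union t h j (j′ ∷ w) = maxIn-++ (h j) (maxIn-Union t h j′ w)

bound : ∀ {I : Set} → (I → FinSet) → List I → ℕ
bound x v = max 0 (Union x v)

≤-bound : ∀ {I : Set} (x : I → FinSet) {v : List I} {i y} → i ∈ v → y ∈ x i → y ≤ bound x v
≤-bound x {v} i∈v y∈xi = All.lookup (xs≤max 0 (Union x v)) (∈-Union⁺ x i∈v y∈xi)

samePiece : ∀ {I : Set} → DecidableEquality I → {x : I → FinSet} → PairwiseDisjoint x →
  ∀ {i j y} → y ∈ x i → y ∈ x j → i ≡ j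
samePiece _≟_ disj {i} {j} y∈xi y∈xj with i ≟ j
... | yes i≡j = i≡j
... | no i≢j = contradiction y∈xj (disj i j i≢j _ y∈xi)

disjoint-∘ : ∀ {I J : Set} {x : I → FinSet} → PairwiseDisjoint x →
  (f : J → I) → Injective _≡_ _≡_ f → PairwiseDisjoint (x ∘ f)
disjoint-∘ disj f inj i j i≢j = disj (f i) (f j) (i≢j ∘ inj)

module Pieces (s : ℕ → FinSet) where

  minPiece : ∀ {a} → MinFU s a → ∃[ p ] IsMin (s p) a
  minPiece (z , (v , _ , z≐) , (a∈z , a≤)) =
    let p , p∈v , a∈sp = ∈-Union⁻ s v (to (z≐ _) a∈z)
    in p , a∈sp , λ k k∈sp → a≤ k (from (z≐ k) (∈-Union⁺ s p∈v k∈sp))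

  maxPiece : ∀ {b} → MaxFU s b → ∃[ p ] IsMax (s p) b
  maxPiece (z , (v , _ , z≐) , (b∈z , ≤b)) =
    let p , p∈v , b∈sp = ∈-Union⁻ s v (to (z≐ _) b∈z)
    in p , b∈sp , λ k k∈sp → ≤b k (from (z≐ k) (∈-Union⁺ s p∈v k∈sp))

  onlyPart : (∀ i → NonEmpty (s i)) → PairwiseDisjoint s → ∀ {p c} → Part s p (s c) → p ≡ c
  onlyPart nonEmpty disj {p} (v , _ , sc≐ , p∈v) with s p in sp≡ | nonEmpty p
  ... | []    | sp≢[] = contradiction refl sp≢[]
  ... | y ∷ _ | _     = samePiece _≟_ disj y∈sp (from (sc≐ y) (∈-Union⁺ s p∈v y∈sp))
    where y∈sp = subst (y ∈_) (sym sp≡) (here refl)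

increasing⇒injective : ∀ {A : Set} {_⊏_ : Rel A 0ℓ} → Trichotomous _≡_ _⊏_ →
  (f : A → ℕ) → (∀ {i j} → i ⊏ j → f i < f j) → Injective _≡_ _≡_ f
increasing⇒injective cmp f inc {i} {j} fi≡fj with cmp i j
... | tri< i⊏j _ _ = contradiction fi≡fj (<⇒≢ (inc i⊏j))
... | tri≈ _ i≡j _ = i≡j
... | tri> _ _ j⊏i = contradiction (sym fi≡fj) (<⇒≢ (inc j⊏i))

stepwise⇒increasing : (f : ℕ → ℕ) → (∀ j → f j < f (suc j)) → ∀ {i j} → i < j → f i < f j
stepwise⇒increasing f step {i} {suc j} i<1+j with m≤n⇒m<n∨m≡n (≤-pred i<1+j)
... | inj₁ i<j  = <-trans (stepwise⇒increasing f step i<j) (step j)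
... | inj₂ refl = step j

module Enumeration {P : Pred ℕ 0ℓ} (infinite : Infinite P) where

  enum : ℕ → ℕ
  enum zero = proj₁ (infinite 0)
  enum (suc j) = proj₁ (infinite (suc (enum j)))

  enum-∈ : ∀ j → P (enum j)
  enum-∈ zero = proj₂ (proj₂ (infinite 0))
  enum-∈ (suc j) = proj₂ (proj₂ (infinite (suc (enum j))))

  enum-injective : Injective _≡_ _≡_ enum
  enum-injective = increasing⇒injective <-cmp enum
    (stepwise⇒increasing enum (λ j → proj₁ (proj₂ (infinite (suc (enum j))))))

lookup-injective : ∀ {X : Set} {xs : List X} → Unique xs → Injective _≡_ _≡_ (lookup xs)
lookup-injective {xs = x ∷ xs} (x∉ ∷ _) {Fin.zero} {Fin.zero} _ = refl
lookup-injective {xs = x ∷ xs} (x∉ ∷ _) {Fin.zero} {Fin.suc j} x≡ = contradiction x≡ (All.lookup x∉ (∈-lookup j))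
lookup-injective {xs = x ∷ xs} (x∉ ∷ _) {Fin.suc i} {Fin.zero} ≡x = contradiction (sym ≡x) (All.lookup x∉ (∈-lookup i))
lookup-injective {xs = x ∷ xs} (_ ∷ u) {Fin.suc i} {Fin.suc j} eq = cong Fin.suc (lookup-injective u eq)

takeInjective : ∀ {X : Set} {n} {xs : List X} → Unique xs → n ≤ length xs →
  Σ (Fin n → X) λ g → Injective _≡_ _≡_ g × (∀ j → g j ∈ xs)
takeInjective {xs = xs} u n≤ =
  (λ j → lookup xs (inject≤ j n≤)) ,
  (λ eq → Finₚ.inject≤-injective n≤ n≤ _ _ (lookup-injective u eq)) ,
  (λ j → ∈-lookup _)

length-filter-split : ∀ {X : Set} {P : Pred X 0ℓ} (P? : Decidable P) (xs : List X) →
  length (filter P? xs) + length (filter (∁? P?) xs) ≡ length xs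
length-filter-split P? [] = refl
length-filter-split P? (x ∷ xs) with P? x
... | yes _ = cong suc (length-filter-split P? xs)
... | no _  = trans (+-suc _ _) (cong suc (length-filter-split P? xs))

module FarSelection {X : Set} (_≟X_ : DecidableEquality X) (p : X → FinSet)
  (disj : PairwiseDisjoint p) (M : ℕ) where

  Near Far : Pred X 0ℓ
  Near x = Any (_≤ M) (p x)
  Far x = All (M <_) (p x)

  near? : Decidable Near
  near? x = any? (_≤? M) (p x)

  ¬near⇒far : ∀ {x} → ¬ Near x → Far x
  ¬near⇒far {x} ¬near = All.map ≰⇒> (¬Any⇒All¬ (p x) ¬near)

  -- Pigeonhole: distinct near members own distinct points of [0, M].
  fewNear : ∀ {ys} → Unique ys → All Near ys → length ys ≤ suc M
  fewNear {ys} u near = Finₚ.injective⇒≤ point-injective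
    where
    witness : ∀ i → ∃[ y ] (y ∈ p (lookup ys i) × y ≤ M)
    witness i = find (All.lookup near (∈-lookup i))
    point : Fin (length ys) → Fin (suc M)
    point i = fromℕ< (s≤s (proj₂ (proj₂ (witness i))))
    point-injective : Injective _≡_ _≡_ point
    point-injective {i} {j} eq with witness i | witness j
      | Finₚ.fromℕ<-injective _ _ (s≤s (proj₂ (proj₂ (witness i)))) (s≤s (proj₂ (proj₂ (witness j)))) eq
    ... | y , y∈i , _ | .y , y∈j , _ | refl = lookup-injective u (samePiece _≟X_ disj y∈i y∈j)

  selectFar : ∀ n (xs : List X) → Unique xs → suc M + n ≤ length xs →
    Σ (Fin n → X) λ g → Injective _≡_ _≡_ g × (∀ j → Far (g j))
  selectFar n xs u len =
    let g , g-inj , g∈ = takeInjective (Uniqueₚ.filter⁺ (∁? near?) u) enough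
    in g , g-inj , λ j → ¬near⇒far (proj₂ (∈-filter⁻ (∁? near?) {xs = xs} (g∈ j)))
    where
    nearCount : length (filter near? xs) ≤ suc M
    nearCount = fewNear (Uniqueₚ.filter⁺ near? u) (All.tabulate (proj₂ ∘ ∈-filter⁻ near? {xs = xs}))
    enough : n ≤ length (filter (∁? near?) xs)
    enough = +-cancelˡ-≤ (suc M) n _ (≤-trans len (≤-trans
      (≤-reflexive (sym (length-filter-split near? xs))) (+-monoˡ-≤ _ nearCount)))

module Construction (s : ℕ → FinSet) (nonEmpty : ∀ i → NonEmpty (s i)) (disj : PairwiseDisjoint s)
  (family : ∀ (N : ℕ) → Σ (Fin (suc N) → ℕ) λ idx →
     (∀ (k l : Fin (suc N)) → k Fin.< l → idx k < idx l) × CompleteMeshGraph s (s ∘ idx))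
  (A B : Pred ℕ 0ℓ) (infA : Infinite (A ∩ MinFU s)) (infB : Infinite (B ∩ MaxFU s)) (n : ℕ) where

  open Pieces s
  module EA = Enumeration infA
  module EB = Enumeration infB

  a : Fin n → ℕ
  a j = EA.enum (toℕ j)

  a∈A : ∀ j → A (a j)
  a∈A j = proj₁ (EA.enum-∈ (toℕ j))

  P : Fin n → ℕ
  P j = proj₁ (minPiece (proj₂ (EA.enum-∈ (toℕ j))))

  P-min : ∀ j → IsMin (s (P j)) (a j)
  P-min j = proj₂ (minPiece (proj₂ (EA.enum-∈ (toℕ j))))

  P-injective : Injective _≡_ _≡_ P
  P-injective {i} {j} Pi≡Pj = Finₚ.toℕ-injective (EA.enum-injective
    (isMin-unique (P-min i) (subst (λ q → IsMin (s q) (a j)) (sym Pi≡Pj) (P-min j))))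

  -- The bounds M, M₂ and the selections are opaque: only their stated
  -- properties are used, and unfolding them makes type checking very slow.
  opaque
    M : ℕ
    M = bound s (tabulate P)

    P-below : ∀ j {y} → y ∈ s (P j) → y ≤ M
    P-below j = ≤-bound s (∈-tabulate⁺ j)

  -- Layer 2: n distinct members I j of a family with complete meshing graph,
  -- chosen (by pigeonhole among M+1+n members) with all points above M.
  idx : Fin (suc (M + n)) → ℕ
  idx = proj₁ (family (M + n))

  complete : CompleteMeshGraph s (s ∘ idx)
  complete = proj₂ (proj₂ (family (M + n)))

  idx-injective : Injective _≡_ _≡_ idx
  idx-injective = increasing⇒injective Finₚ.<-cmp idx (proj₁ (proj₂ (family (M + n))) _ _)

  module FarI = FarSelection Finₚ._≟_ (s ∘ idx) (disjoint-∘ disj idx idx-injective) M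

  opaque
    selectedI : Σ (Fin n → Fin (suc (M + n))) λ g → Injective _≡_ _≡_ g × (∀ j → FarI.Far (g j))
    selectedI = FarI.selectFar n (allFin _) (Uniqueₚ.allFin⁺ _) (≤-reflexive (sym (length-tabulate (λ k → k))))

  I : Fin n → ℕ
  I j = idx (proj₁ selectedI j)

  I-injective : Injective _≡_ _≡_ I
  I-injective = proj₁ (proj₂ selectedI) ∘ idx-injective

  I-above : ∀ j {y} → y ∈ s (I j) → M < y
  I-above j = All.lookup (proj₂ (proj₂ selectedI) j)

  opaque
    M₂ : ℕ
    M₂ = bound s (tabulate P ++ tabulate I)

    P-below₂ : ∀ j {y} → y ∈ s (P j) → y ≤ M₂
    P-below₂ j = ≤-bound s (∈-++⁺ˡ (∈-tabulate⁺ j))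

    I-below₂ : ∀ j {y} → y ∈ s (I j) → y ≤ M₂
    I-below₂ j = ≤-bound s (∈-++⁺ʳ (tabulate P) (∈-tabulate⁺ j))

  candidateQ : ℕ → ℕ
  candidateQ l = proj₁ (maxPiece (proj₂ (EB.enum-∈ l)))

  candidateQ-max : ∀ l → IsMax (s (candidateQ l)) (EB.enum l)
  candidateQ-max l = proj₂ (maxPiece (proj₂ (EB.enum-∈ l)))

  candidateQ-injective : Injective _≡_ _≡_ candidateQ
  candidateQ-injective {i} {j} eq = EB.enum-injective (isMax-unique (candidateQ-max i)
    (subst (λ q → IsMax (s q) (EB.enum j)) (sym eq) (candidateQ-max j)))

  module FarQ = FarSelection _≟_ (s ∘ candidateQ) (disjoint-∘ disj candidateQ candidateQ-injective) M₂

  opaque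
    selectedQ : Σ (Fin n → ℕ) λ g → Injective _≡_ _≡_ g × (∀ j → FarQ.Far (g j))
    selectedQ = FarQ.selectFar n (upTo (suc (M₂ + n))) (Uniqueₚ.upTo⁺ _) (≤-reflexive (sym (length-upTo _)))

  Q : Fin n → ℕ
  Q j = candidateQ (proj₁ selectedQ j)

  b : Fin n → ℕ
  b j = EB.enum (proj₁ selectedQ j)

  b∈B : ∀ j → B (b j)
  b∈B j = proj₁ (EB.enum-∈ (proj₁ selectedQ j))

  Q-max : ∀ j → IsMax (s (Q j)) (b j)
  Q-max j = candidateQ-max (proj₁ selectedQ j)

  Q-injective : Injective _≡_ _≡_ Q
  Q-injective = proj₁ (proj₂ selectedQ) ∘ candidateQ-injective

  Q-above₂ : ∀ j {y} → y ∈ s (Q j) → M₂ < y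
  Q-above₂ j = All.lookup (proj₂ (proj₂ selectedQ) j)

  v : Fin n → List ℕ
  v j = P j ∷ I j ∷ Q j ∷ []

  t : Fin n → FinSet
  t = Union s ∘ v

  ∈-t⁻ : ∀ j {y} → y ∈ t j → y ∈ s (P j) ⊎ y ∈ s (I j) ⊎ y ∈ s (Q j)
  ∈-t⁻ j = ∈-Union₃⁻ s

  -- min t j = a j: a j is ≤ M and ≤ M₂, while I j lies above M and Q j above M₂.
  t-min : ∀ j → IsMin (t j) (a j)
  t-min j = ∈-Union⁺ s {v j} (here refl) a∈P , λ y y∈ → lower (∈-t⁻ j y∈)
    where
    a∈P : a j ∈ s (P j)
    a∈P = proj₁ (P-min j)
    lower : ∀ {y} → y ∈ s (P j) ⊎ y ∈ s (I j) ⊎ y ∈ s (Q j) → a j ≤ y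
    lower (inj₁ y∈P) = proj₂ (P-min j) _ y∈P
    lower (inj₂ (inj₁ y∈I)) = <⇒≤ (≤-<-trans (P-below j a∈P) (I-above j y∈I))
    lower (inj₂ (inj₂ y∈Q)) = <⇒≤ (≤-<-trans (P-below₂ j a∈P) (Q-above₂ j y∈Q))

  -- max t j = b j, since the points of P j and I j are ≤ M₂ < b j.
  t-max : ∀ j → IsMax (t j) (b j)
  t-max j = ∈-Union⁺ s {v j} (there (there (here refl))) b∈Q , λ y y∈ → upper (∈-t⁻ j y∈)
    where
    b∈Q : b j ∈ s (Q j)
    b∈Q = proj₁ (Q-max j)
    upper : ∀ {y} → y ∈ s (P j) ⊎ y ∈ s (I j) ⊎ y ∈ s (Q j) → y ≤ b j
    upper (inj₁ y∈P) = <⇒≤ (≤-<-trans (P-below₂ j y∈P) (Q-above₂ j b∈Q))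
    upper (inj₂ (inj₁ y∈I)) = <⇒≤ (≤-<-trans (I-below₂ j y∈I) (Q-above₂ j b∈Q))
    upper (inj₂ (inj₂ y∈Q)) = proj₂ (Q-max j) _ y∈Q

  -- A common point of t j and t j′ lies in the same layer of both (the layers
  -- occupy disjoint ranges), hence in a common piece, forcing j ≡ j′.
  t-disjoint : PairwiseDisjoint t
  t-disjoint j j′ j≢j′ y y∈j y∈j′ = layers (∈-t⁻ j y∈j) (∈-t⁻ j′ y∈j′)
    where
    same : ∀ {p q} → y ∈ s p → y ∈ s q → p ≡ q
    same = samePiece _≟_ disj
    layers : y ∈ s (P j) ⊎ y ∈ s (I j) ⊎ y ∈ s (Q j) → y ∈ s (P j′) ⊎ y ∈ s (I j′) ⊎ y ∈ s (Q j′) → ⊥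
    layers (inj₁ p) (inj₁ p′) = j≢j′ (P-injective (same p p′))
    layers (inj₁ p) (inj₂ (inj₁ i′)) = <⇒≱ (I-above j′ i′) (P-below j p)
    layers (inj₁ p) (inj₂ (inj₂ q′)) = <⇒≱ (Q-above₂ j′ q′) (P-below₂ j p)
    layers (inj₂ (inj₁ i)) (inj₁ p′) = <⇒≱ (I-above j i) (P-below j′ p′)
    layers (inj₂ (inj₁ i)) (inj₂ (inj₁ i′)) = j≢j′ (I-injective (same i i′))
    layers (inj₂ (inj₁ i)) (inj₂ (inj₂ q′)) = <⇒≱ (Q-above₂ j′ q′) (I-below₂ j i)
    layers (inj₂ (inj₂ q)) (inj₁ p′) = <⇒≱ (Q-above₂ j q) (P-below₂ j′ p′)
    layers (inj₂ (inj₂ q)) (inj₂ (inj₁ i′)) = <⇒≱ (Q-above₂ j q) (I-below₂ j′ i′)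
    layers (inj₂ (inj₂ q)) (inj₂ (inj₂ q′)) = j≢j′ (Q-injective (same q q′))

  -- t j and t j′ mesh through their I-pieces, which are distinct members of the meshing family.
  t-complete : CompleteMeshGraph s t
  t-complete j j′ j≢j′ with complete (proj₁ selectedI j) (proj₁ selectedI j′) (j≢j′ ∘ proj₁ (proj₂ selectedI))
  ... | p , q , p-part , q-part , mesh =
    I j , I j′ , I-part j , I-part j′ ,
    subst₂ (λ x y → Mesh (s x) (s y)) (onlyPart nonEmpty disj p-part) (onlyPart nonEmpty disj q-part) mesh
    where
    I-part : ∀ j → Part s (I j) (t j)
    I-part j = v j , (λ ()) , (λ _ → mk⇔ id id) , there (here refl)

  FU-t : ∀ z → InFU t z → InFU s z × MinMaxIn A B z
  FU-t z ([] , w≢[] , _) = contradiction refl w≢[]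
  FU-t z (j ∷ w , _ , z≐) = inFU-s , ∈⇒nonEmpty (proj₁ (proj₁ (proj₂ minA))) , minA , maxB
    where
    inFU-s : InFU s z
    inFU-s = concatMap v (j ∷ w) , (λ ()) ,
      λ k → subst (λ L → (k ∈ z) ⇔ (k ∈ L)) (Union-Union s v (j ∷ w)) (z≐ k)
    minA : MinIn A z
    minA = minIn-≐ z≐ (minIn-Union t (λ i → a i , t-min i , a∈A i) j w)
    maxB : MaxIn B z
    maxB = maxIn-≐ z≐ (maxIn-Union t (λ i → b i , t-max i , b∈B i) j w)

  meshedFamily : Σ (Fin n → FinSet) λ t →
    (∀ i → NonEmpty (t i)) × PairwiseDisjoint t ×
    (∀ z → InFU t z → InFU s z × MinMaxIn A B z) × CompleteMeshGraph s t
  meshedFamily = t , (λ j → ∈⇒nonEmpty (proj₁ (t-min j))) , t-disjoint , FU-t , t-complete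

mainTheorem9 : (s : ℕ → FinSet) → (∀ i → NonEmpty (s i)) → PairwiseDisjoint s →
    (∀ (n : ℕ) → Σ (Fin (suc n) → ℕ) λ idx →
       (∀ (k l : Fin (suc n)) → k Fin.< l → idx k < idx l) ×
       CompleteMeshGraph s (s ∘ idx)) →
    (A B : Pred ℕ 0ℓ) → Infinite (A ∩ MinFU s) → Infinite (B ∩ MaxFU s) →
    Meshed s (MinMaxIn A B)
mainTheorem9 s nonEmpty disj family A B infA infB n =
  Construction.meshedFamily s nonEmpty disj family A B infA infB n
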